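{- Let $g,h$ be normalized arithmetic functions with $h$ non-vanishing. For all integers $1\le m\le n$, $$A_{n,m}^{g,h}=\sum_{k=1}^{n-m+1}g(k)\,\frac{H(n-1)}{H(n-k)}\,A_{n-k,m-1}^{g,h}.$$
   Context: An arithmetic function is a map $\mathbb{N}\to\mathbb{C}$; normalized means value $1$ at $1$. Define $P_0^{g,h}(x):=1$ and for $n\ge1$, $P_n^{g,h}(x):=\frac{x}{h(n)}\sum_{k=1}^n g(k)P_{n-k}^{g,h}(x)$. Let $H(n):=\prod_{k=1}^n h(k)$, $H(0):=1$, and write $H(n)P_n^{g,h}(x)=\sum_{m=0}^nA_{n,m}^{g,h}x^m$ (so $A_{0,0}^{g,h}=1$ and $A_{n,0}^{g,h}=0$ for $n\ge1$). -}

module Defs where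

open import Level using (Level; suc; _⊔_)
open import Algebra.Bundles using (CommutativeRing)
open import Data.Nat as ℕ using (ℕ; zero; _∸_; _≤ᵇ_)
import Data.Nat as N
open import Data.Bool using (if_then_else_)
open import Relation.Nullary using (¬_)

-- A field (commutative ring with a total inverse operation, inverting every
-- nonzero element, Lean-style).  ℂ is an instance.
record Field (c ℓ : Level) : Set (suc (c ⊔ ℓ)) where
  field
    commutativeRing : CommutativeRing c ℓ
  open CommutativeRing commutativeRing public
  field
    _⁻¹     : Carrier → Carrier
    ⁻¹-cong : ∀ {x y} → x ≈ y → x ⁻¹ ≈ y ⁻¹
    inverse : ∀ x → ¬ (x ≈ 0#) → x * (x ⁻¹) ≈ 1#
    0≉1     : ¬ (0# ≈ 1#)

module _ {c ℓ : Level} (F : Field c ℓ) where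
  open Field F

  Σ₁ : ℕ → (ℕ → Carrier) → Carrier
  Σ₁ zero    f = 0#
  Σ₁ (N.suc n) f = Σ₁ n f + f (N.suc n)

  module _ (g h : ℕ → Carrier) where

    H : ℕ → Carrier
    H zero      = 1#
    H (N.suc n) = H n * h (N.suc n)

    -- Polynomials are represented by coefficient functions ℕ → Carrier.
    -- table n j = P_j (coefficient function) for every j ≤ n.
    table : ℕ → ℕ → ℕ → Carrier
    table zero j zero        = 1#
    table zero j (N.suc m)   = 0#
    table (N.suc n) j m = if j ≤ᵇ n then table n j m else new m
      where
        -- coefficients of P_{n+1}(x) = x/h(n+1) · Σ_{k=1}^{n+1} g(k) P_{n+1-k}(x)
        new : ℕ → Carrier
        new zero      = 0#
        new (N.suc m) = (h (N.suc n) ⁻¹) * Σ₁ (N.suc n) (λ k → g k * table n (N.suc n ∸ k) m)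

    -- P n m = coefficient of x^m in P_n^{g,h}(x)
    P : ℕ → ℕ → Carrier
    P n = table n n

    A : ℕ → ℕ → Carrier
    A n m = H n * P n m

{-# OPTIONS --safe #-}
module Submission where

open import Defs
open import Data.Nat using (ℕ; zero; suc; _∸_; _+_; _≤_; _<_; z≤n; s≤s; _≤ᵇ_; _<ᵇ_)
open import Relation.Nullary using (¬_)
import Data.Nat.Properties as ℕ
open import Data.Bool using (true; false; T)
open import Data.Sum using (inj₁; inj₂)
open import Data.Empty using (⊥-elim)
open import Relation.Binary.PropositionalEquality as ≡ using (_≡_)

-- Coefficients of P_n only live in degrees ≤ n, so in the recurrence for
-- A_{n,m} the terms with n - k < m - 1 vanish; the remaining ones are the
-- recurrence of P_n multiplied out by H(n) = H(n-1) h(n), with each P_{n-k}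
-- rewritten as H(n-k)⁻¹ A_{n-k}.

1+n∸k<m : ∀ {n m k} → m ≤ n → n ∸ m + 1 < k → k ≤ suc n → suc n ∸ k < m
1+n∸k<m {n} {m} {k} m≤n n∸m+1<k k≤1+n = ≡.subst (suc n ∸ k <_) 1+n∸[n∸m+1]≡m (ℕ.∸-monoʳ-< n∸m+1<k k≤1+n)
  where
  1+n∸[n∸m+1]≡m : suc n ∸ (n ∸ m + 1) ≡ m
  1+n∸[n∸m+1]≡m = ≡.trans (≡.cong (suc n ∸_) (ℕ.+-comm (n ∸ m) 1)) (ℕ.m∸[m∸n]≡n m≤n)

module _ {c ℓ} (F : Field c ℓ) where
  open Field F renaming (_+_ to _⊕_) hiding (zero)
  open import Relation.Binary.Reasoning.Setoid setoid

  ⁻¹-cancelˡ : ∀ {x} y → ¬ x ≈ 0# → x ⁻¹ * (x * y) ≈ y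
  ⁻¹-cancelˡ {x} y x≉0 = begin
    x ⁻¹ * (x * y) ≈⟨ *-assoc _ _ _ ⟨
    (x ⁻¹ * x) * y ≈⟨ *-congʳ (trans (*-comm _ _) (inverse x x≉0)) ⟩
    1# * y         ≈⟨ *-identityˡ y ⟩
    y              ∎

  *-⁻¹-cancelˡ : ∀ {x} y → ¬ x ≈ 0# → x * (x ⁻¹ * y) ≈ y
  *-⁻¹-cancelˡ {x} y x≉0 = begin
    x * (x ⁻¹ * y) ≈⟨ *-assoc _ _ _ ⟨
    (x * x ⁻¹) * y ≈⟨ *-congʳ (inverse x x≉0) ⟩
    1# * y         ≈⟨ *-identityˡ y ⟩
    y              ∎

  x≉0∧y≉0⇒x*y≉0 : ∀ {x y} → ¬ x ≈ 0# → ¬ y ≈ 0# → ¬ x * y ≈ 0#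
  x≉0∧y≉0⇒x*y≉0 {x} {y} x≉0 y≉0 xy≈0 = y≉0 (begin
    y              ≈⟨ ⁻¹-cancelˡ y x≉0 ⟨
    x ⁻¹ * (x * y) ≈⟨ *-congˡ xy≈0 ⟩
    x ⁻¹ * 0#      ≈⟨ zeroʳ _ ⟩
    0#             ∎)

  Σ₁-cong : ∀ n {f f′} → (∀ k → 1 ≤ k → k ≤ n → f k ≈ f′ k) → Σ₁ F n f ≈ Σ₁ F n f′
  Σ₁-cong zero    f≈f′ = refl
  Σ₁-cong (suc n) f≈f′ =
    +-cong (Σ₁-cong n λ k 1≤k k≤n → f≈f′ k 1≤k (ℕ.m≤n⇒m≤1+n k≤n)) (f≈f′ (suc n) (s≤s z≤n) ℕ.≤-refl)

  Σ₁-zero : ∀ n {f} → (∀ k → 1 ≤ k → k ≤ n → f k ≈ 0#) → Σ₁ F n f ≈ 0#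
  Σ₁-zero n {f} f≈0 = trans (Σ₁-cong n f≈0) (zeros n)
    where
    zeros : ∀ n → Σ₁ F n (λ _ → 0#) ≈ 0#
    zeros zero    = refl
    zeros (suc n) = trans (+-identityʳ _) (zeros n)

  *-distribˡ-Σ₁ : ∀ n a f → a * Σ₁ F n f ≈ Σ₁ F n (λ k → a * f k)
  *-distribˡ-Σ₁ zero    a f = zeroʳ a
  *-distribˡ-Σ₁ (suc n) a f = trans (distribˡ a _ _) (+-congʳ (*-distribˡ-Σ₁ n a f))

  Σ₁-truncate : ∀ {n a} f → a ≤ n → (∀ k → a < k → k ≤ n → f k ≈ 0#) → Σ₁ F n f ≈ Σ₁ F a f
  Σ₁-truncate {zero}  f z≤n     _   = refl
  Σ₁-truncate {suc n} {a} f a≤1+n f≈0 with ℕ.m≤n⇒m<n∨m≡n a≤1+n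
  ... | inj₂ ≡.refl = refl
  ... | inj₁ (s≤s a≤n) = begin
    Σ₁ F n f ⊕ f (suc n) ≈⟨ +-cong (Σ₁-truncate f a≤n λ k a<k k≤n → f≈0 k a<k (ℕ.m≤n⇒m≤1+n k≤n))
                                   (f≈0 (suc n) (s≤s a≤n) ℕ.≤-refl) ⟩
    Σ₁ F a f ⊕ 0#        ≈⟨ +-identityʳ _ ⟩
    Σ₁ F a f             ∎

  module _ (g h : ℕ → Carrier) where

    table-stable : ∀ {n j} m → j ≤ n → table F g h n j m ≡ P F g h j m
    table-stable {zero}      m z≤n    = ≡.refl
    table-stable {suc n} {j} m j≤1+n with ℕ.m≤n⇒m<n∨m≡n j≤1+n
    ... | inj₂ ≡.refl = ≡.refl
    ... | inj₁ (s≤s j≤n) with j ≤ᵇ n in eq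
    ...   | true  = table-stable m j≤n
    ...   | false = ⊥-elim (≡.subst T eq (ℕ.≤⇒≤ᵇ j≤n))

    P-suc : ∀ n m →
      P F g h (suc n) (suc m) ≈ h (suc n) ⁻¹ * Σ₁ F (suc n) (λ k → g k * P F g h (suc n ∸ k) m)
    P-suc n m with n <ᵇ n in eq
    ... | true  = ⊥-elim (ℕ.n≮n n (ℕ.<ᵇ⇒< n n (≡.subst T (≡.sym eq) _)))
    ... | false = *-congˡ (Σ₁-cong (suc n) λ where
      (suc k) _ _ → *-congˡ (reflexive (table-stable m (ℕ.m∸n≤m n k))))

    P-vanishes-above-degree : ∀ {i m} → i < m → P F g h i m ≈ 0#
    P-vanishes-above-degree {i} i<m = vanish i ℕ.≤-refl i<m
      where
      vanish : ∀ b {i m} → i ≤ b → i < m → P F g h i m ≈ 0#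
      vanish _       {zero}  {suc m} _          _           = refl
      vanish (suc b) {suc i} {suc m} (s≤s i≤b) (s≤s i<m) = begin
        P F g h (suc i) (suc m)                                 ≈⟨ P-suc i m ⟩
        h (suc i) ⁻¹ * Σ₁ F (suc i) (λ k → g k * P F g h (suc i ∸ k) m) ≈⟨ *-congˡ (Σ₁-zero (suc i) λ where
          (suc k) _ _ → let i-k≤i = ℕ.m∸n≤m i k in
            trans (*-congˡ (vanish b (ℕ.≤-trans i-k≤i i≤b) (ℕ.≤-<-trans i-k≤i i<m))) (zeroʳ _)) ⟩
        h (suc i) ⁻¹ * 0#                                       ≈⟨ zeroʳ _ ⟩
        0#                                                      ∎

    module _ (h≉0 : ∀ n → ¬ h (suc n) ≈ 0#) where

      H-nonzero : ∀ n → ¬ H F g h n ≈ 0#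
      H-nonzero zero    1≈0 = 0≉1 (sym 1≈0)
      H-nonzero (suc n)     = x≉0∧y≉0⇒x*y≉0 (H-nonzero n) (h≉0 n)

      A-suc : ∀ n m →
        A F g h (suc n) (suc m) ≈ Σ₁ F (suc n) (λ k → H F g h n * (g k * P F g h (suc n ∸ k) m))
      A-suc n m = begin
        (H F g h n * h (suc n)) * P F g h (suc n) (suc m) ≈⟨ *-congˡ (P-suc n m) ⟩
        (H F g h n * h (suc n)) * (h (suc n) ⁻¹ * S)    ≈⟨ *-assoc _ _ _ ⟩
        H F g h n * (h (suc n) * (h (suc n) ⁻¹ * S))    ≈⟨ *-congˡ (*-⁻¹-cancelˡ S (h≉0 n)) ⟩
        H F g h n * S                                  ≈⟨ *-distribˡ-Σ₁ (suc n) _ _ ⟩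
        Σ₁ F (suc n) (λ k → H F g h n * (g k * P F g h (suc n ∸ k) m)) ∎
        where S = Σ₁ F (suc n) (λ k → g k * P F g h (suc n ∸ k) m)

      H-cancel : ∀ {m} n j x →
        H F g h n * (x * P F g h j m) ≈ (x * (H F g h n * H F g h j ⁻¹)) * A F g h j m
      H-cancel {m} n j x = sym (begin
        (x * (Hn * Hj ⁻¹)) * (Hj * Pj)  ≈⟨ solve 4 (λ x a b p → (x ∙ (a ∙ b)) ∙ p ⊜ a ∙ (x ∙ (b ∙ p)))
                                                  refl x Hn (Hj ⁻¹) (Hj * Pj) ⟩
        Hn * (x * (Hj ⁻¹ * (Hj * Pj))) ≈⟨ *-congˡ (*-congˡ (⁻¹-cancelˡ Pj (H-nonzero j))) ⟩
        Hn * (x * Pj)                  ∎)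
        where
        open import Algebra.Solver.CommutativeMonoid *-commutativeMonoid using (solve; _⊜_) renaming (_⊕_ to _∙_)
        Hn = H F g h n
        Hj = H F g h j
        Pj = P F g h j m

mainTheorem8 : ∀ {c ℓ} (F : Field c ℓ) (g h : ℕ → Field.Carrier F) →
    Field._≈_ F (g 1) (Field.1# F) →
    Field._≈_ F (h 1) (Field.1# F) →
    (∀ n → ¬ Field._≈_ F (h (suc n)) (Field.0# F)) →
    ∀ n m → 1 ≤ m → m ≤ n →
    Field._≈_ F (A F g h n m)
      (Σ₁ F (n ∸ m + 1) (λ k →
        Field._*_ F (Field._*_ F (g k)
          (Field._*_ F (H F g h (n ∸ 1)) (Field._⁻¹ F (H F g h (n ∸ k)))))
          (A F g h (n ∸ k) (m ∸ 1))))
mainTheorem8 F g h _ _ h≉0 (suc n) (suc m) (s≤s z≤n) (s≤s m≤n) = begin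
  A F g h (suc n) (suc m)            ≈⟨ A-suc F g h h≉0 n m ⟩
  Σ₁ F (suc n) term                  ≈⟨ Σ₁-truncate F term n∸m+1≤1+n high-terms-vanish ⟩
  Σ₁ F (n ∸ m + 1) term              ≈⟨ Σ₁-cong F (n ∸ m + 1) (λ k _ _ → H-cancel F g h h≉0 n (suc n ∸ k) (g k)) ⟩
  Σ₁ F (n ∸ m + 1) (λ k → (g k * (H F g h n * H F g h (suc n ∸ k) ⁻¹)) * A F g h (suc n ∸ k) m) ∎
  where
  open Field F using (Carrier; setoid; _≈_; _*_; _⁻¹; 0#; *-congˡ; zeroʳ)
  open import Relation.Binary.Reasoning.Setoid setoid
  term : ℕ → Carrier
  term k = H F g h n * (g k * P F g h (suc n ∸ k) m)
  n∸m+1≤1+n : n ∸ m + 1 ≤ suc n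
  n∸m+1≤1+n = ≡.subst (_≤ suc n) (ℕ.+-comm 1 (n ∸ m)) (s≤s (ℕ.m∸n≤m n m))
  high-terms-vanish : ∀ k → n ∸ m + 1 < k → k ≤ suc n → term k ≈ 0#
  high-terms-vanish k n∸m+1<k k≤1+n = begin
    H F g h n * (g k * P F g h (suc n ∸ k) m) ≈⟨ *-congˡ (*-congˡ (P-vanishes-above-degree F g h (1+n∸k<m m≤n n∸m+1<k k≤1+n))) ⟩
    H F g h n * (g k * 0#)                   ≈⟨ *-congˡ (zeroʳ _) ⟩
    H F g h n * 0#                           ≈⟨ zeroʳ _ ⟩
    0#                                       ∎
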